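{- Let $r\ge 1$ and $n\ge 3$ be integers, let $m(r)=\lceil (r+1)/2\rceil$, and let $\mathcal{H}$ be the $3$-uniform hypergraph defined below. Let $S\subset V(\mathcal{H})$ be a set that meets every column of $\mathcal{H}$ and contains no hyperedge of $\mathcal{H}$. If $r$ is even then $|S|\le m(r)\binom{n}{2}$, and if $r$ is odd then $|S|\le m(r)\binom{n}{2}+rn$.
   Context: $\mathcal{H}$ is the $3$-uniform hypergraph with vertex set $\{1,\dots,r\}\times E(K_n)$, where $K_n$ is the complete graph on $[n]$; the vertex $(i,f)$ represents the event that the edge $f$ of $K_n$ receives distance (colour) $i$. For each edge $f$ of $K_n$, the column of $f$ is the set $\{(i,f): 1\le i\le r\}$. Three vertices $(a,f_1),(b,f_2),(c,f_3)$ form a hyperedge of $\mathcal{H}$ if and only if $f_1,f_2,f_3$ are the three edges of a triangle in $K_n$ and the numbers $a,b,c$ violate the triangle inequality, i.e. one of them is strictly larger than the sum of the other two. -}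

module Defs where

open import Data.Nat using (ℕ; _+_; _<_; ⌈_/2⌉)
open import Data.Bool using (Bool; true; false; if_then_else_; _∧_)
open import Data.Fin using (Fin; toℕ; _<?_)
open import Data.Fin.Base using () renaming (_<_ to _<ᶠ_)
open import Data.List using (map; allFin)
open import Data.Nat.ListAction using (sum)
open import Data.Product using (∃)
open import Data.Sum using (_⊎_)
open import Data.Empty using (⊥)
open import Relation.Binary.PropositionalEquality using (_≡_)
open import Relation.Nullary.Decidable using (⌊_⌋)

-- A set S ⊆ V(H) = {1..r} × E(K_n) is encoded as a Boolean predicate
-- S i u v, meaning "(i+1, {u,v}) ∈ S"; only entries with u < v (as Fin n)
-- are meaningful: the edge {u,v} of K_n with u < v.  Colour i : Fin r
-- stands for the distance toℕ i + 1 ∈ {1,…,r}.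
VertexSet : ℕ → ℕ → Set
VertexSet r n = Fin r → Fin n → Fin n → Bool

dist : ∀ {r} → Fin r → ℕ
dist i = ℕ.suc (toℕ i) where import Data.Nat as ℕ

Violates : ℕ → ℕ → ℕ → Set
Violates a b c = (b + c < a) ⊎ (a + c < b) ⊎ (a + b < c)

card : ∀ {r n} → VertexSet r n → ℕ
card {r} {n} S =
  sum (map (λ i → sum (map (λ u → sum (map (λ v →
    if ⌊ u <? v ⌋ ∧ S i u v then 1 else 0) (allFin n))) (allFin n))) (allFin r))

MeetsEveryColumn : ∀ {r n} → VertexSet r n → Set
MeetsEveryColumn {r} {n} S =
  (u v : Fin n) → u <ᶠ v → ∃ λ (i : Fin r) → S i u v ≡ true

HyperedgeFree : ∀ {r n} → VertexSet r n → Set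
HyperedgeFree {r} {n} S =
  (x y z : Fin n) → x <ᶠ y → y <ᶠ z →
  (a b c : Fin r) → S a x y ≡ true → S b y z ≡ true → S c x z ≡ true →
  Violates (dist a) (dist b) (dist c) → ⊥

m : ℕ → ℕ
m r = ⌈ r + 1 /2⌉

module Submission where

-- Write M = m(r), e = r mod 2, so that 2M + e = r + 2 and
-- e ≤ 1, and give every edge {u,v} of K_n the weight g(u,v) = number of
-- colours that S puts on it; then |S| is the total weight of K_n.
--
-- If the three edges of a triangle carry non-empty colour
--     sets A, B, C with no violating triple, and α, β, γ are their least
--     colours, then every colour of A lies in [α, min(r, β + γ)], and
--     similarly for B, C; adding the six resulting bounds gives
--     2(|A| + |B| + |C|) ≤ 3r + 6, i.e. every triangle weighs at most 3M + e.
-- (2) Mantel-type induction.  In any edge-weighted complete graph on ℓ ≥ 3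
--     vertices whose triangles all weigh at most 3M + e, the total weight is
--     at most M·C(ℓ,2) + e·ℓ.  For ℓ ∈ {3, 4} this follows from the triangle
--     bound directly; for ℓ ≥ 5 either every edge weighs at most M, or an edge
--     xy weighs more than M, and then the ℓ - 2 triangles through xy bound
--     the weight at x and y, so that removing both vertices and using the
--     induction hypothesis suffices.

open import Defs
open import Data.Nat using (ℕ; _+_; _*_; _≤_; _%_)
open import Data.Nat.Combinatorics using (_C_)
open import Data.Product using (_×_)
open import Relation.Binary.PropositionalEquality using (_≡_)

open import Data.Nat using (zero; suc; _∸_; _<_; _<?_; z≤n; s≤s)
open import Data.Nat.Properties
  using ( +-mono-≤; +-monoʳ-≤; *-monoʳ-≤; *-monoˡ-≤; ≤-trans; m≤m+n; ≮⇒≥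
        ; +-cancelʳ-≤; *-cancelˡ-<; *-zeroʳ; *-identityʳ; +-identityʳ; suc-injective
        ; ≤-pred; n<1+n; +-comm; *-comm; *-distribˡ-+; m≤m*n; *-cancelˡ-≤; ≤-reflexive
        ; m+[n∸m]≡n; <⇒≤; +-suc; *-suc; module ≤-Reasoning)
open import Data.Nat.DivMod using (m%n<n)
open import Data.Nat.Combinatorics using (nC1≡n; nCk+nC[k+1]≡[n+1]C[k+1])
open import Data.Nat.ListAction using (sum)
open import Data.Nat.ListAction.Properties using (sum-↭)
open import Data.Nat.Tactic.RingSolver using (solve-∀)
open import Data.Bool using (Bool; true; false; if_then_else_; _∧_)
open import Data.Empty using (⊥-elim)
open import Data.Fin as Fin using (Fin; toℕ)
open import Data.Fin.Properties using (toℕ<n)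
import Data.Fin.Properties as Fin
open import Data.List using (List; []; _∷_; _++_; map; length; allFin)
open import Data.List.Properties using (map-cong; map-tabulate; length-tabulate)
open import Data.List.Membership.Propositional using (_∈_; find; lose)
open import Data.List.Membership.Propositional.Properties using (∈-∃++)
open import Data.List.Relation.Unary.Any using (here; there; any?)
open import Data.List.Relation.Unary.All using ([]; _∷_) renaming (lookup to All-lookup)
open import Data.List.Relation.Unary.AllPairs as AllPairs using ([]; _∷_)
open import Data.List.Relation.Unary.Unique.Propositional using (Unique)
open import Data.List.Relation.Unary.Unique.Propositional.Properties using (allFin⁺)
open import Data.List.Relation.Binary.Permutation.Propositional using (_↭_; ↭-trans; ↭-prep; ↭⇒↭ₛ)
open import Data.List.Relation.Binary.Permutation.Propositional.Properties
  using (shift; map⁺; ∈-resp-↭; ↭-length)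
import Data.List.Relation.Binary.Permutation.Setoid.Properties as Perm
open import Data.Product using (∃; ∃₂; _,_; proj₂)
open import Data.Sum using (_⊎_; inj₁; inj₂)
open import Function using (_∘_)
open import Relation.Binary.Bundles using (StrictTotalOrder)
open import Relation.Binary.Definitions using (tri<; tri≈; tri>)
open import Relation.Binary.PropositionalEquality using (refl; sym; trans; cong; cong₂; subst; _≢_; setoid; module ≡-Reasoning)
open import Relation.Nullary using (¬_; yes; no)
open import Relation.Nullary.Decidable using (⌊_⌋)

sum-map-+ : {A : Set} (f g : A → ℕ) (L : List A) →
  sum (map (λ a → f a + g a) L) ≡ sum (map f L) + sum (map g L)
sum-map-+ f g [] = refl
sum-map-+ f g (a ∷ L) =
  trans (cong (f a + g a +_) (sum-map-+ f g L)) (interchange (f a) (g a) _ _)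
  where
  interchange : ∀ p q s t → p + q + (s + t) ≡ p + s + (q + t)
  interchange = solve-∀

sum-map-const : {A : Set} (c : ℕ) (L : List A) → sum (map (λ _ → c) L) ≡ length L * c
sum-map-const c [] = refl
sum-map-const c (_ ∷ L) = cong (c +_) (sum-map-const c L)

sum-swap : {A B : Set} (f : A → B → ℕ) (As : List A) (Bs : List B) →
  sum (map (λ a → sum (map (f a) Bs)) As) ≡ sum (map (λ b → sum (map (λ a → f a b) As)) Bs)
sum-swap f [] Bs = sym (trans (sum-map-const 0 Bs) (*-zeroʳ (length Bs)))
sum-swap f (a ∷ As) Bs =
  trans (cong (sum (map (f a) Bs) +_) (sum-swap f As Bs))
        (sym (sum-map-+ (f a) (λ b → sum (map (λ a → f a b) As)) Bs))

sum-bounded : {A : Set} (f : A → ℕ) (c : ℕ) (L : List A) →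
  (∀ {a} → a ∈ L → f a ≤ c) → sum (map f L) ≤ length L * c
sum-bounded f c [] _ = z≤n
sum-bounded f c (a ∷ L) bnd = +-mono-≤ (bnd (here refl)) (sum-bounded f c L (bnd ∘ there))

∈⇒↭∷ : {A : Set} {x : A} {L : List A} → x ∈ L → ∃ λ L′ → L ↭ x ∷ L′
∈⇒↭∷ {x = x} x∈L with ys , zs , refl ← ∈-∃++ x∈L = ys ++ zs , shift x ys zs

∈∈⇒↭∷∷ : {A : Set} {x y : A} {L : List A} → x ∈ L → y ∈ L → x ≢ y →
  ∃ λ L″ → L ↭ x ∷ y ∷ L″
∈∈⇒↭∷∷ x∈L y∈L x≢y with L′ , L↭ ← ∈⇒↭∷ x∈L with ∈-resp-↭ L↭ y∈L
... | here y≡x = ⊥-elim (x≢y (sym y≡x))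
... | there y∈L′ with L″ , L′↭ ← ∈⇒↭∷ y∈L′ = L″ , ↭-trans L↭ (↭-prep _ L′↭)

unique-resp-↭ : {A : Set} {L L′ : List A} → L ↭ L′ → Unique L → Unique L′
unique-resp-↭ {A} p = Perm.Unique-resp-↭ (setoid A) (↭⇒↭ₛ p)

module _ {a ℓ₁ ℓ₂} (O : StrictTotalOrder a ℓ₁ ℓ₂) where
  open StrictTotalOrder O using (Carrier; _≈_; compare) renaming (_<_ to _⊏_)

  from-increasing : (Q : Carrier → Carrier → Carrier → Set) →
    (∀ {x y z} → Q x y z → Q y x z) → (∀ {x y z} → Q x y z → Q x z y) →
    (∀ {x y z} → x ⊏ y → y ⊏ z → Q x y z) →
    ∀ x y z → ¬ x ≈ y → ¬ y ≈ z → ¬ x ≈ z → Q x y z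
  from-increasing Q swap₁₂ swap₂₃ increasing x y z x≉y y≉z x≉z
    with compare x y | compare y z | compare x z
  ... | tri≈ _ x≈y _ | _ | _ = ⊥-elim (x≉y x≈y)
  ... | _ | tri≈ _ y≈z _ | _ = ⊥-elim (y≉z y≈z)
  ... | _ | _ | tri≈ _ x≈z _ = ⊥-elim (x≉z x≈z)
  ... | tri< x<y _ _ | tri< y<z _ _ | _ = increasing x<y y<z
  ... | tri< x<y _ _ | tri> _ _ z<y | tri< x<z _ _ = swap₂₃ (increasing x<z z<y)
  ... | tri< x<y _ _ | tri> _ _ z<y | tri> _ _ z<x = swap₂₃ (swap₁₂ (increasing z<x x<y))
  ... | tri> _ _ y<x | tri< y<z _ _ | tri< x<z _ _ = swap₁₂ (increasing y<x x<z)
  ... | tri> _ _ y<x | tri< y<z _ _ | tri> _ _ z<x = swap₁₂ (swap₂₃ (increasing y<z z<x))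
  ... | tri> _ _ y<x | tri> _ _ z<y | _ = swap₁₂ (swap₂₃ (swap₁₂ (increasing z<y y<x)))

suc-C2 : ∀ ℓ → suc ℓ C 2 ≡ ℓ C 2 + ℓ
suc-C2 ℓ = begin
  suc ℓ C 2         ≡⟨ sym (nCk+nC[k+1]≡[n+1]C[k+1] ℓ 1) ⟩
  ℓ C 1 + ℓ C 2     ≡⟨ cong (_+ ℓ C 2) (nC1≡n ℓ) ⟩
  ℓ + ℓ C 2         ≡⟨ +-comm ℓ (ℓ C 2) ⟩
  ℓ C 2 + ℓ         ∎
  where open ≡-Reasoning

halve : ∀ a b e → e ≤ 1 → 2 * a ≤ 2 * b + e → a ≤ b
halve a b e e≤1 2a≤2b+e = ≤-pred (*-cancelˡ-< 2 a (suc b) (begin-strict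
  2 * a       ≤⟨ 2a≤2b+e ⟩
  2 * b + e   ≤⟨ +-monoʳ-≤ (2 * b) e≤1 ⟩
  2 * b + 1   <⟨ n<1+n (2 * b + 1) ⟩
  suc (2 * b + 1) ≡⟨ double-suc b ⟩
  2 * suc b   ∎))
  where
  open ≤-Reasoning
  double-suc : ∀ b → suc (2 * b + 1) ≡ 2 * suc b
  double-suc = solve-∀

module WeightedGraph {V : Set} (w : V → V → ℕ) (loopless : ∀ x → w x x ≡ 0) where

  edge : V → V → ℕ
  edge x y = w x y + w y x

  edge-loop : ∀ x → edge x x ≡ 0
  edge-loop x = cong₂ _+_ (loopless x) (loopless x)

  edge-sym : ∀ x y → edge x y ≡ edge y x
  edge-sym x y = +-comm (w x y) (w y x)

  triangle-weight : V → V → V → ℕ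
  triangle-weight x y z = edge x y + edge y z + edge x z

  triangle-weight-swap₁₂ : ∀ x y z → triangle-weight y x z ≡ triangle-weight x y z
  triangle-weight-swap₁₂ x y z =
    trans (cong (λ e → e + edge x z + edge y z) (edge-sym y x)) (swap (edge x y) (edge x z) (edge y z))
    where
    swap : ∀ a b c → a + b + c ≡ a + c + b
    swap = solve-∀

  triangle-weight-swap₂₃ : ∀ x y z → triangle-weight x z y ≡ triangle-weight x y z
  triangle-weight-swap₂₃ x y z =
    trans (cong (λ e → edge x z + e + edge x y) (edge-sym z y)) (reverse (edge x z) (edge y z) (edge x y))
    where
    reverse : ∀ a b c → a + b + c ≡ c + b + a
    reverse = solve-∀

  weight : List V → ℕ
  weight L = sum (map (λ u → sum (map (w u) L)) L)

  weight-↭ : ∀ {L L′} → L ↭ L′ → weight L ≡ weight L′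
  weight-↭ {L} {L′} p = begin
    sum (map (λ u → sum (map (w u) L)) L)   ≡⟨ cong sum (map-cong (λ u → sum-↭ (map⁺ (w u) p)) L) ⟩
    sum (map (λ u → sum (map (w u) L′)) L)  ≡⟨ sum-↭ (map⁺ (λ u → sum (map (w u) L′)) p) ⟩
    sum (map (λ u → sum (map (w u) L′)) L′) ∎
    where open ≡-Reasoning

  weight-∷ : ∀ x L → weight (x ∷ L) ≡ weight L + sum (map (edge x) L)
  weight-∷ x L = begin
    (w x x + out) + sum (map (λ u → w u x + sum (map (w u) L)) L)
      ≡⟨ cong₂ _+_ (cong (_+ out) (loopless x)) (sum-map-+ (λ u → w u x) (λ u → sum (map (w u) L)) L) ⟩
    out + (inn + weight L)       ≡⟨ rearrange out inn (weight L) ⟩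
    weight L + (out + inn)       ≡⟨ cong (weight L +_) (sym (sum-map-+ (w x) (λ z → w z x) L)) ⟩
    weight L + sum (map (edge x) L) ∎
    where
    open ≡-Reasoning
    out = sum (map (w x) L)
    inn = sum (map (λ u → w u x) L)
    rearrange : ∀ a b c → a + (b + c) ≡ c + (a + b)
    rearrange = solve-∀

  weight-∷∷ : ∀ x y L →
    weight (x ∷ y ∷ L) ≡ weight L + (edge x y + (sum (map (edge x) L) + sum (map (edge y) L)))
  weight-∷∷ x y L = begin
    weight (x ∷ y ∷ L)                     ≡⟨ weight-∷ x (y ∷ L) ⟩
    weight (y ∷ L) + (edge x y + X)        ≡⟨ cong (_+ (edge x y + X)) (weight-∷ y L) ⟩
    weight L + Y + (edge x y + X)          ≡⟨ rearrange (weight L) Y (edge x y) X ⟩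
    weight L + (edge x y + (X + Y))        ∎
    where
    open ≡-Reasoning
    X = sum (map (edge x) L)
    Y = sum (map (edge y) L)
    rearrange : ∀ a b c d → a + b + (c + d) ≡ a + (c + (d + b))
    rearrange = solve-∀

  module TriangleBounded (M e : ℕ) (e≤1 : e ≤ 1)
    (triangle : ∀ x y z → x ≢ y → y ≢ z → x ≢ z → triangle-weight x y z ≤ 3 * M + e)
    where

    bound : ℕ → ℕ
    bound ℓ = M * (ℓ C 2) + e * ℓ

    light-bound : ∀ L → (∀ {x y} → x ∈ L → y ∈ L → edge x y ≤ M) → weight L ≤ M * (length L C 2)
    light-bound [] _ = z≤n
    light-bound (x ∷ L) light = begin
      weight (x ∷ L)                      ≡⟨ weight-∷ x L ⟩
      weight L + sum (map (edge x) L)     ≤⟨ +-mono-≤ (light-bound L λ p q → light (there p) (there q))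
                                                       (sum-bounded (edge x) M L (light (here refl) ∘ there)) ⟩
      M * (length L C 2) + length L * M   ≡⟨ cong (M * (length L C 2) +_) (*-comm (length L) M) ⟩
      M * (length L C 2) + M * length L   ≡⟨ sym (*-distribˡ-+ M (length L C 2) (length L)) ⟩
      M * (length L C 2 + length L)       ≡⟨ cong (M *_) (sym (suc-C2 (length L))) ⟩
      M * (suc (length L) C 2)            ∎
      where open ≤-Reasoning

    heavy-or-light : ∀ L → (∃₂ λ x y → x ∈ L × y ∈ L × M < edge x y) ⊎
                           (∀ {x y} → x ∈ L → y ∈ L → edge x y ≤ M)
    heavy-or-light L with any? (λ x → any? (λ y → M <? edge x y) L) L
    ... | yes heavy with x , x∈L , heavyₓ ← find heavy with y , y∈L , M<xy ← find heavyₓ =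
      inj₁ (x , y , x∈L , y∈L , M<xy)
    ... | no ¬heavy = inj₂ λ x∈L y∈L → ≮⇒≥ λ M<xy → ¬heavy (lose x∈L (lose y∈L M<xy))

    bound-3 : ∀ {a b c} → Unique (a ∷ b ∷ c ∷ []) → weight (a ∷ b ∷ c ∷ []) ≤ bound 3
    bound-3 {a} {b} {c} ((a≢b ∷ a≢c ∷ []) ∷ (b≢c ∷ []) ∷ [] ∷ []) = begin
      weight (a ∷ b ∷ c ∷ [])         ≡⟨ weight-∷∷ a b (c ∷ []) ⟩
      weight (c ∷ []) + at-ab         ≡⟨ cong (_+ at-ab) (weight-∷ c []) ⟩
      0 + (edge a b + ((edge a c + 0) + (edge b c + 0)))
                                      ≡⟨ rearrange (edge a b) (edge b c) (edge a c) ⟩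
      edge a b + edge b c + edge a c  ≤⟨ triangle a b c a≢b b≢c a≢c ⟩
      3 * M + e                       ≤⟨ +-monoʳ-≤ (3 * M) (m≤m*n e 3) ⟩
      3 * M + e * 3                   ≡⟨ cong (_+ e * 3) (*-comm 3 M) ⟩
      bound 3                         ∎
      where
      open ≤-Reasoning
      at-ab = edge a b + (sum (map (edge a) (c ∷ [])) + sum (map (edge b) (c ∷ [])))
      rearrange : ∀ p q s → 0 + (p + ((s + 0) + (q + 0))) ≡ p + q + s
      rearrange = solve-∀

    -- Base case ℓ = 4: the four triangles of K₄ cover every edge twice.
    bound-4 : ∀ {a b c d} → Unique (a ∷ b ∷ c ∷ d ∷ []) → weight (a ∷ b ∷ c ∷ d ∷ []) ≤ bound 4
    bound-4 {a} {b} {c} {d} ((a≢b ∷ a≢c ∷ a≢d ∷ []) ∷ (b≢c ∷ b≢d ∷ []) ∷ (c≢d ∷ []) ∷ [] ∷ []) = begin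
      weight (a ∷ b ∷ c ∷ d ∷ [])  ≤⟨ *-cancelˡ-≤ 2 twice ⟩
      2 * (3 * M + e)              ≡⟨ expand M e ⟩
      M * 6 + e * 2                ≤⟨ +-monoʳ-≤ (M * 6) (*-monoʳ-≤ e (s≤s (s≤s z≤n))) ⟩
      bound 4                      ∎
      where
      open ≤-Reasoning
      at-ab = edge a b + (sum (map (edge a) (c ∷ d ∷ [])) + sum (map (edge b) (c ∷ d ∷ [])))
      twice : 2 * weight (a ∷ b ∷ c ∷ d ∷ []) ≤ 2 * (2 * (3 * M + e))
      twice = begin
        2 * weight (a ∷ b ∷ c ∷ d ∷ [])
          ≡⟨ cong (2 *_) (trans (weight-∷∷ a b (c ∷ d ∷ [])) (cong (_+ at-ab) (weight-∷∷ c d []))) ⟩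
        2 * ((0 + (edge c d + (0 + 0))) + at-ab)
          ≡⟨ regroup (edge a b) (edge a c) (edge a d) (edge b c) (edge b d) (edge c d) ⟩
        triangle-weight a b c + triangle-weight a b d + triangle-weight a c d + triangle-weight b c d
          ≤⟨ +-mono-≤ (+-mono-≤ (+-mono-≤ (triangle a b c a≢b b≢c a≢c) (triangle a b d a≢b b≢d a≢d))
                                (triangle a c d a≢c c≢d a≢d))
                      (triangle b c d b≢c c≢d b≢d) ⟩
        (3 * M + e) + (3 * M + e) + (3 * M + e) + (3 * M + e)
          ≡⟨ four (3 * M + e) ⟩
        2 * (2 * (3 * M + e)) ∎
        where
        regroup : ∀ ab ac ad bc bd cd →
          2 * ((0 + (cd + (0 + 0))) + (ab + ((ac + (ad + 0)) + (bc + (bd + 0))))) ≡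
          (ab + bc + ac) + (ab + bd + ad) + (ac + cd + ad) + (bc + cd + bd)
        regroup = solve-∀
        four : ∀ k → k + k + k + k ≡ 2 * (2 * k)
        four = solve-∀
      expand : ∀ M e → 2 * (3 * M + e) ≡ M * 6 + e * 2
      expand = solve-∀

    heavy-distinct : ∀ {x y} → M < edge x y → x ≢ y
    heavy-distinct {x} M<xx refl with subst (M <_) (edge-loop x) M<xx
    ... | ()

    -- Linear arithmetic of the heavy step: if ℓ ≥ 1 triangles of capacity
    -- 3M + e share an edge of weight G > M, and X is the weight of their
    -- other edges, then G + X ≤ M(2ℓ + 1) + e.
    heavy-arith : ∀ ℓ G X → 1 ≤ ℓ → suc M ≤ G → ℓ * G + X ≤ ℓ * (3 * M + e) →
      G + X ≤ M * (2 * ℓ + 1) + e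
    heavy-arith (suc q) G X _ M<G shared = +-cancelʳ-≤ (q * suc M) (G + X) _ (begin
      G + X + q * suc M                      ≤⟨ +-monoʳ-≤ (G + X) (*-monoʳ-≤ q M<G) ⟩
      G + X + q * G                          ≡⟨ rearrange G X (q * G) ⟩
      suc q * G + X                          ≤⟨ shared ⟩
      suc q * (3 * M + e)                    ≡⟨ expand q M e ⟩
      3 * M + e + q * (3 * M) + q * e        ≤⟨ +-monoʳ-≤ (3 * M + e + q * (3 * M)) q*e≤q ⟩
      3 * M + e + q * (3 * M) + q            ≡⟨ collect q M e ⟩
      M * (2 * suc q + 1) + e + q * suc M    ∎)
      where
      open ≤-Reasoning
      q*e≤q : q * e ≤ q
      q*e≤q = ≤-trans (*-monoʳ-≤ q e≤1) (≤-reflexive (*-identityʳ q))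
      rearrange : ∀ G X qG → G + X + qG ≡ G + qG + X
      rearrange = solve-∀
      expand : ∀ q M e → suc q * (3 * M + e) ≡ 3 * M + e + q * (3 * M) + q * e
      expand = solve-∀
      collect : ∀ q M e → 3 * M + e + q * (3 * M) + q ≡ M * (2 * suc q + 1) + e + q * suc M
      collect = solve-∀

    -- The ℓ triangles through a heavy edge xy bound the total weight at x and y.
    heavy-pair : ∀ {x y} ℓ L → length L ≡ ℓ → 1 ≤ ℓ → Unique (x ∷ y ∷ L) → M < edge x y →
      edge x y + (sum (map (edge x) L) + sum (map (edge y) L)) ≤ M * (2 * ℓ + 1) + e
    heavy-pair {x} {y} _ L refl 1≤ℓ ((x≢y ∷ x≢L) ∷ y≢L ∷ _) M<xy =
      heavy-arith (length L) G _ 1≤ℓ M<xy (begin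
        length L * G + (sum (map (edge x) L) + sum (map (edge y) L))
          ≡⟨ cong₂ _+_ (sym (sum-map-const G L)) (sym (sum-map-+ (edge x) (edge y) L)) ⟩
        sum (map (λ _ → G) L) + sum (map (λ z → edge x z + edge y z) L)
          ≡⟨ sym (sum-map-+ (λ _ → G) (λ z → edge x z + edge y z) L) ⟩
        sum (map (λ z → G + (edge x z + edge y z)) L)
          ≤⟨ sum-bounded _ (3 * M + e) L through ⟩
        length L * (3 * M + e) ∎)
      where
      open ≤-Reasoning
      G = edge x y
      through : ∀ {z} → z ∈ L → G + (edge x z + edge y z) ≤ 3 * M + e
      through {z} z∈L = begin
        G + (edge x z + edge y z) ≡⟨ rearrange G (edge x z) (edge y z) ⟩
        G + edge y z + edge x z   ≤⟨ triangle x y z x≢y (All-lookup y≢L z∈L) (All-lookup x≢L z∈L) ⟩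
        3 * M + e                 ∎
        where
        rearrange : ∀ a b c → a + (b + c) ≡ a + c + b
        rearrange = solve-∀

    bound-step : ∀ ℓ → bound ℓ + (M * (2 * ℓ + 1) + e) ≤ bound (suc (suc ℓ))
    bound-step ℓ = begin
      bound ℓ + (M * (2 * ℓ + 1) + e)             ≤⟨ m≤m+n _ e ⟩
      bound ℓ + (M * (2 * ℓ + 1) + e) + e         ≡⟨ regroup M (ℓ C 2) ℓ e ⟩
      M * (ℓ C 2 + ℓ + suc ℓ) + e * suc (suc ℓ)   ≡⟨ cong (λ k → M * k + e * suc (suc ℓ)) C2-step ⟩
      bound (suc (suc ℓ))                         ∎
      where
      open ≤-Reasoning
      C2-step : ℓ C 2 + ℓ + suc ℓ ≡ suc (suc ℓ) C 2
      C2-step = sym (trans (suc-C2 (suc ℓ)) (cong (_+ suc ℓ) (suc-C2 ℓ)))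
      regroup : ∀ M C ℓ e → M * C + e * ℓ + (M * (2 * ℓ + 1) + e) + e ≡ M * (C + ℓ + suc ℓ) + e * suc (suc ℓ)
      regroup = solve-∀

    heavy-step : ∀ ℓ → 1 ≤ ℓ → ∀ L → length L ≡ suc (suc ℓ) → Unique L →
      (∀ L″ → length L″ ≡ ℓ → Unique L″ → weight L″ ≤ bound ℓ) →
      ∀ {x y} → x ∈ L → y ∈ L → M < edge x y → weight L ≤ bound (suc (suc ℓ))
    heavy-step ℓ 1≤ℓ L len u IH {x} {y} x∈L y∈L M<xy
      with L″ , L↭ ← ∈∈⇒↭∷∷ x∈L y∈L (heavy-distinct M<xy) = begin
      weight L                         ≡⟨ weight-↭ L↭ ⟩
      weight (x ∷ y ∷ L″)              ≡⟨ weight-∷∷ x y L″ ⟩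
      weight L″ + (edge x y + (sum (map (edge x) L″) + sum (map (edge y) L″)))
        ≤⟨ +-mono-≤ (IH L″ len″ (AllPairs.tail (AllPairs.tail u″))) (heavy-pair ℓ L″ len″ 1≤ℓ u″ M<xy) ⟩
      bound ℓ + (M * (2 * ℓ + 1) + e)  ≤⟨ bound-step ℓ ⟩
      bound (suc (suc ℓ))              ∎
      where
      open ≤-Reasoning
      u″ : Unique (x ∷ y ∷ L″)
      u″ = unique-resp-↭ L↭ u
      len″ : length L″ ≡ ℓ
      len″ = suc-injective (suc-injective (trans (sym (↭-length L↭)) len))

    mantel : ∀ k L → length L ≡ 3 + k → Unique L → weight L ≤ bound (3 + k)
    mantel 0 (_ ∷ _ ∷ _ ∷ []) refl u = bound-3 u
    mantel 1 (_ ∷ _ ∷ _ ∷ _ ∷ []) refl u = bound-4 u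
    mantel (suc (suc k)) L len u with heavy-or-light L
    ... | inj₁ (_ , _ , x∈L , y∈L , M<xy) = heavy-step (3 + k) (s≤s z≤n) L len u (mantel k) x∈L y∈L M<xy
    ... | inj₂ all-light = begin
      weight L                  ≤⟨ light-bound L all-light ⟩
      M * (length L C 2)        ≡⟨ cong (λ ℓ → M * (ℓ C 2)) len ⟩
      M * ((5 + k) C 2)         ≤⟨ m≤m+n _ _ ⟩
      bound (5 + k)             ∎
      where open ≤-Reasoning

    weight-bound : ∀ L → 3 ≤ length L → Unique L → weight L ≤ bound (length L)
    weight-bound L 3≤ℓ u =
      subst (λ ℓ → weight L ≤ bound ℓ) (m+[n∸m]≡n 3≤ℓ)
            (mantel (length L ∸ 3) L (sym (m+[n∸m]≡n 3≤ℓ)) u)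

count : ∀ {r} → (Fin r → Bool) → ℕ
count {r} P = sum (map (λ i → if P i then 1 else 0) (allFin r))

count-suc : ∀ {r} (P : Fin (suc r) → Bool) →
  count P ≡ (if P Fin.zero then 1 else 0) + count (P ∘ Fin.suc)
count-suc {r} P = cong ((if P Fin.zero then 1 else 0) +_) (cong sum
  (trans (map-tabulate Fin.suc (λ i → if P i then 1 else 0))
         (sym (map-tabulate (λ i → i) (λ i → if P (Fin.suc i) then 1 else 0)))))

least : ∀ {r} (P : Fin r → Bool) → ∃ (λ i → P i ≡ true) →
  ∃ λ a → P a ≡ true × (∀ i → P i ≡ true → toℕ a ≤ toℕ i)
least P (Fin.zero , P0) = Fin.zero , P0 , λ _ _ → z≤n
least P (Fin.suc j , Pj) with P Fin.zero in P0
... | true = Fin.zero , P0 , λ _ _ → z≤n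
... | false with a , Pa , a-least ← least (P ∘ Fin.suc) (j , Pj) = Fin.suc a , Pa , above
  where
  above : ∀ i → P i ≡ true → toℕ (Fin.suc a) ≤ toℕ i
  above Fin.zero P0′ with () ← trans (sym P0) P0′
  above (Fin.suc i) Pi = s≤s (a-least i Pi)

count-interval : ∀ {r} (P : Fin r → Bool) l u → l ≤ u →
  (∀ i → P i ≡ true → l ≤ toℕ i × toℕ i < u) → count P + l ≤ u
count-interval {zero} P l u l≤u _ = l≤u
count-interval {suc r} P l u l≤u inside rewrite count-suc P with P Fin.zero in P0
... | true with inside Fin.zero P0
...   | z≤n , s≤s _ = s≤s (count-interval (P ∘ Fin.suc) 0 _ z≤n
                              λ i Pi → z≤n , ≤-pred (proj₂ (inside (Fin.suc i) Pi)))
count-interval {suc r} P zero u _ inside | false =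
  count-interval (P ∘ Fin.suc) 0 u z≤n λ i Pi → z≤n , <⇒≤ (proj₂ (inside (Fin.suc i) Pi))
count-interval {suc r} P (suc l) (suc u) (s≤s l≤u) inside | false =
  subst (_≤ suc u) (sym (+-suc _ l)) (s≤s (count-interval (P ∘ Fin.suc) l u l≤u
    λ i Pi → let l<i , i<u = inside (Fin.suc i) Pi in ≤-pred l<i , ≤-pred i<u))

triangle-arith : ∀ a b c α β γ r →
  a + α ≤ suc β + suc γ → b + β ≤ suc α + suc γ → c + γ ≤ suc α + suc β →
  a + α ≤ r → b + β ≤ r → c + γ ≤ r → 2 * (a + b + c) ≤ 3 * r + 6
triangle-arith a b c α β γ r a≤βγ b≤αγ c≤αβ a≤r b≤r c≤r =
  +-cancelʳ-≤ (2 * (α + β + γ)) (2 * (a + b + c)) (3 * r + 6) (begin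
    2 * (a + b + c) + 2 * (α + β + γ)
      ≡⟨ double a b c α β γ ⟩
    (a + α) + (b + β) + (c + γ) + ((a + α) + (b + β) + (c + γ))
      ≤⟨ +-mono-≤ (+-mono-≤ (+-mono-≤ a≤βγ b≤αγ) c≤αβ) (+-mono-≤ (+-mono-≤ a≤r b≤r) c≤r) ⟩
    (suc β + suc γ) + (suc α + suc γ) + (suc α + suc β) + (r + r + r)
      ≡⟨ collect α β γ r ⟩
    3 * r + 6 + 2 * (α + β + γ) ∎)
  where
  open ≤-Reasoning
  double : ∀ a b c α β γ → 2 * (a + b + c) + 2 * (α + β + γ) ≡
    (a + α) + (b + β) + (c + γ) + ((a + α) + (b + β) + (c + γ))
  double = solve-∀
  collect : ∀ α β γ r → (suc β + suc γ) + (suc α + suc γ) + (suc α + suc β) + (r + r + r) ≡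
    3 * r + 6 + 2 * (α + β + γ)
  collect = solve-∀

-- Triangle lemma: if the edges of a triangle carry non-empty colour sets
-- P, Q, R ⊆ {1,…,r} containing no triple that violates the triangle
-- inequality, then 2(|P| + |Q| + |R|) ≤ 3r + 6.  Each colour of P is at
-- least min P, at most r and (by the triangle inequality) at most
-- min Q + min R; similarly for Q and R.
colour-triangle : ∀ {r} (P Q R : Fin r → Bool) →
  ∃ (λ i → P i ≡ true) → ∃ (λ j → Q j ≡ true) → ∃ (λ k → R k ≡ true) →
  (∀ i j k → P i ≡ true → Q j ≡ true → R k ≡ true → ¬ Violates (dist i) (dist j) (dist k)) →
  2 * (count P + count Q + count R) ≤ 3 * r + 6
colour-triangle {r} P Q R P≢∅ Q≢∅ R≢∅ satisfies
  with α , Pα , α-least ← least P P≢∅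
     | β , Qβ , β-least ← least Q Q≢∅
     | γ , Rγ , γ-least ← least R R≢∅ =
  triangle-arith (count P) (count Q) (count R) (toℕ α) (toℕ β) (toℕ γ) r
    (count-interval P _ _ (<⇒≤ (P-below α Pα)) λ i Pi → α-least i Pi , P-below i Pi)
    (count-interval Q _ _ (<⇒≤ (Q-below β Qβ)) λ j Qj → β-least j Qj , Q-below j Qj)
    (count-interval R _ _ (<⇒≤ (R-below γ Rγ)) λ k Rk → γ-least k Rk , R-below k Rk)
    (count-interval P _ _ (<⇒≤ (toℕ<n α)) λ i Pi → α-least i Pi , toℕ<n i)
    (count-interval Q _ _ (<⇒≤ (toℕ<n β)) λ j Qj → β-least j Qj , toℕ<n j)
    (count-interval R _ _ (<⇒≤ (toℕ<n γ)) λ k Rk → γ-least k Rk , toℕ<n k)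
  where
  P-below : ∀ i → P i ≡ true → toℕ i < dist β + dist γ
  P-below i Pi = ≮⇒≥ λ βγ<i → satisfies i β γ Pi Qβ Rγ (inj₁ βγ<i)
  Q-below : ∀ j → Q j ≡ true → toℕ j < dist α + dist γ
  Q-below j Qj = ≮⇒≥ λ αγ<j → satisfies α j γ Pα Qj Rγ (inj₂ (inj₁ αγ<j))
  R-below : ∀ k → R k ≡ true → toℕ k < dist α + dist β
  R-below k Rk = ≮⇒≥ λ αβ<k → satisfies α β k Pα Qβ Rk (inj₂ (inj₂ αβ<k))

parity≤1 : ∀ r → r % 2 ≤ 1
parity≤1 r = ≤-pred (m%n<n r 2)

double-m : ∀ r → 2 * m r + r % 2 ≡ r + 2
double-m zero = refl
double-m (suc zero) = refl
double-m (suc (suc r)) = trans (cong (_+ r % 2) (*-suc 2 (m r))) (cong (2 +_) (double-m r))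

module ColourWeights {r n} (S : VertexSet r n) where

  chosen : Fin r → Fin n → Fin n → ℕ
  chosen i u v = if ⌊ u Fin.<? v ⌋ ∧ S i u v then 1 else 0

  chosen-< : ∀ i {u v} → u Fin.< v → chosen i u v ≡ (if S i u v then 1 else 0)
  chosen-< i {u} {v} u<v with u Fin.<? v
  ... | yes _ = refl
  ... | no u≮v = ⊥-elim (u≮v u<v)

  chosen-≮ : ∀ i {u v} → ¬ u Fin.< v → chosen i u v ≡ 0
  chosen-≮ i {u} {v} u≮v with u Fin.<? v
  ... | yes u<v = ⊥-elim (u≮v u<v)
  ... | no _ = refl

  colours : Fin n → Fin n → ℕ
  colours u v = sum (map (λ i → chosen i u v) (allFin r))

  colours-≮ : ∀ {u v} → ¬ u Fin.< v → colours u v ≡ 0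
  colours-≮ {u} {v} u≮v = begin
    sum (map (λ i → chosen i u v) (allFin r)) ≡⟨ cong sum (map-cong (λ i → chosen-≮ i u≮v) (allFin r)) ⟩
    sum (map (λ _ → 0) (allFin r))            ≡⟨ sum-map-const 0 (allFin r) ⟩
    length (allFin r) * 0                     ≡⟨ *-zeroʳ (length (allFin r)) ⟩
    0                                         ∎
    where open ≡-Reasoning

  open WeightedGraph colours (λ u → colours-≮ (Fin.<-irrefl refl)) public

  -- |S| is the total weight of K_n (exchange the order of summation twice).
  card≡weight : card S ≡ weight (allFin n)
  card≡weight = begin
    sum (map (λ i → sum (map (λ u → sum (map (chosen i u) (allFin n))) (allFin n))) (allFin r))
      ≡⟨ sum-swap (λ i u → sum (map (chosen i u) (allFin n))) (allFin r) (allFin n) ⟩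
    sum (map (λ u → sum (map (λ i → sum (map (chosen i u) (allFin n))) (allFin r))) (allFin n))
      ≡⟨ cong sum (map-cong (λ u → sum-swap (λ i → chosen i u) (allFin r) (allFin n)) (allFin n)) ⟩
    weight (allFin n) ∎
    where open ≡-Reasoning

  edge≡count : ∀ {u v} → u Fin.< v → edge u v ≡ count (λ i → S i u v)
  edge≡count {u} {v} u<v = begin
    colours u v + colours v u ≡⟨ cong₂ _+_ (cong sum (map-cong (λ i → chosen-< i u<v) (allFin r)))
                                         (colours-≮ (Fin.<-asym u<v)) ⟩
    count (λ i → S i u v) + 0 ≡⟨ +-identityʳ _ ⟩
    count (λ i → S i u v)     ∎
    where open ≡-Reasoning

  module _ (meets : MeetsEveryColumn S) (free : HyperedgeFree S) where

    increasing-triangle : ∀ {x y z} → x Fin.< y → y Fin.< z → triangle-weight x y z ≤ 3 * m r + r % 2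
    increasing-triangle {x} {y} {z} x<y y<z = halve _ _ (r % 2) (parity≤1 r) (begin
      2 * (edge x y + edge y z + edge x z)
        ≡⟨ cong (2 *_) (cong₂ _+_ (cong₂ _+_ (edge≡count x<y) (edge≡count y<z)) (edge≡count x<z)) ⟩
      2 * (count (λ i → S i x y) + count (λ i → S i y z) + count (λ i → S i x z))
        ≤⟨ colour-triangle _ _ _ (meets x y x<y) (meets y z y<z) (meets x z x<z) (free x y z x<y y<z) ⟩
      3 * r + 6
        ≡⟨ capacity r ⟩
      2 * (3 * m r + r % 2) + r % 2 ∎)
      where
      open ≤-Reasoning
      x<z = Fin.<-trans x<y y<z
      capacity : ∀ r → 3 * r + 6 ≡ 2 * (3 * m r + r % 2) + r % 2
      capacity r = begin-equality
        3 * r + 6                      ≡⟨ triple r ⟩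
        3 * (r + 2)                    ≡⟨ cong (3 *_) (sym (double-m r)) ⟩
        3 * (2 * m r + r % 2)          ≡⟨ rearrange (m r) (r % 2) ⟩
        2 * (3 * m r + r % 2) + r % 2  ∎
        where
        triple : ∀ r → 3 * r + 6 ≡ 3 * (r + 2)
        triple = solve-∀
        rearrange : ∀ M e → 3 * (2 * M + e) ≡ 2 * (3 * M + e) + e
        rearrange = solve-∀

    triangle : ∀ x y z → x ≢ y → y ≢ z → x ≢ z → triangle-weight x y z ≤ 3 * m r + r % 2
    triangle = from-increasing (Fin.<-strictTotalOrder n) (λ x y z → triangle-weight x y z ≤ 3 * m r + r % 2)
      (λ {x} {y} {z} → subst (_≤ 3 * m r + r % 2) (sym (triangle-weight-swap₁₂ x y z)))
      (λ {x} {y} {z} → subst (_≤ 3 * m r + r % 2) (sym (triangle-weight-swap₂₃ x y z)))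
      increasing-triangle

    open TriangleBounded (m r) (r % 2) (parity≤1 r) triangle using (weight-bound)

    card-bound : 3 ≤ n → card S ≤ m r * (n C 2) + r % 2 * n
    card-bound 3≤n = begin
      card S                              ≡⟨ card≡weight ⟩
      weight (allFin n)                   ≤⟨ weight-bound (allFin n) (≤-trans 3≤n (≤-reflexive (sym vertices))) (allFin⁺ n) ⟩
      m r * (length (allFin n) C 2) + r % 2 * length (allFin n)
                                          ≡⟨ cong (λ ℓ → m r * (ℓ C 2) + r % 2 * ℓ) vertices ⟩
      m r * (n C 2) + r % 2 * n           ∎
      where
      open ≤-Reasoning
      vertices : length (allFin n) ≡ n
      vertices = length-tabulate (λ i → i)

lemma3p4 : (r n : ℕ) → 1 ≤ r → 3 ≤ n → (S : VertexSet r n) →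
    MeetsEveryColumn S → HyperedgeFree S →
    (r % 2 ≡ 0 → card S ≤ m r * (n C 2)) ×
    (r % 2 ≡ 1 → card S ≤ m r * (n C 2) + r * n)
lemma3p4 r n 1≤r 3≤n S meets free = even , odd
  where
  bound : card S ≤ m r * (n C 2) + r % 2 * n
  bound = ColourWeights.card-bound S meets free 3≤n
  even : r % 2 ≡ 0 → card S ≤ m r * (n C 2)
  even r-even = subst (card S ≤_) (trans (cong (λ e → m r * (n C 2) + e * n) r-even) (+-identityʳ _)) bound
  odd : r % 2 ≡ 1 → card S ≤ m r * (n C 2) + r * n
  odd r-odd = ≤-trans bound (+-monoʳ-≤ (m r * (n C 2)) (subst (λ e → e * n ≤ r * n) (sym r-odd) (*-monoˡ-≤ n 1≤r)))
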